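{- Let $0\le\alpha\le1$, $0\le\beta<1$, and let $\mathcal{Z}=\{A_n\mid n\in\mathcal{D}\}$ be a $\preceq_{(\alpha,\beta)}$-compatible bivariate ($m=2$) $P$-polynomial association scheme on the domain $\mathcal{D}\subset\mathbb{N}^2$ with respect to the deg-lex order $\le$. Then $\mathcal{Z}$ is also a bivariate $P$-polynomial association scheme of type $(\alpha,\beta)$ on $\mathcal{D}$ if and only if $\mathcal{D}$ is $\preceq_{(\alpha,\beta)}$-compatible.
   Context: $e_1=(1,0)$, $e_2=(0,1)$; write $A_{10}=A_{e_1}$, $A_{01}=A_{e_2}$ and $\boldsymbol{A}^a=A_{10}^{a_1}A_{01}^{a_2}$. The deg-lex order on $\mathbb{N}^2$: $(i,j)\le(i',j')$ iff $i+j<i'+j'$, or $i+j=i'+j'$ and $j\le j'$. The partial order $\preceq_{(\alpha,\beta)}$: $(i,j)\preceq_{(\alpha,\beta)}(i',j')$ iff $i+\alpha j\le i'+\alpha j'$ and $\beta i+j\le\beta i'+j'$. A polynomial $v(x,y)$ has multidegree $n$ if $v=\sum_{a\le n}f_a x^{a_1}y^{a_2}$ with $f_n\ne0$; it is $\preceq_{(\alpha,\beta)}$-compatible if every monomial exponent $a$ satisfies $a\preceq_{(\alpha,\beta)}n$. A set $\mathcal{D}$ is $\preceq_{(\alpha,\beta)}$-compatible if $a\in\mathcal{D}$, $b\preceq_{(\alpha,\beta)}a$ imply $b\in\mathcal{D}$. A commutative association scheme ($(0,1)$-matrices containing $I$, summing to $J$, closed under transposition, commuting, span closed under multiplication) $\{A_n\mid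 n\in\mathcal{D}\}$ with $e_1,e_2\in\mathcal{D}$ is bivariate $P$-polynomial on $\mathcal{D}$ w.r.t. $\le$ if: (1) $n\in\mathcal{D}$, $0\le n'_i\le n_i$ imply $n'\in\mathcal{D}$; (2) $A_n=v_n(A_{10},A_{01})$ with $v_n$ of multidegree $n$ and all monomial exponents in $\mathcal{D}$; (3) $A_{e_i}\boldsymbol{A}^a\in\mathrm{span}\{\boldsymbol{A}^b\mid b\in\mathcal{D},b\le a+e_i\}$ for $i=1,2$, $a\in\mathcal{D}$; it is $\preceq_{(\alpha,\beta)}$-compatible if moreover each $v_n$ is $\preceq_{(\alpha,\beta)}$-compatible and $A_{e_i}\boldsymbol{A}^a\in\mathrm{span}\{\boldsymbol{A}^b\mid b\in\mathcal{D},b\preceq_{(\alpha,\beta)}a+e_i\}$ for $i=1,2$, $a\in\mathcal{D}$. A scheme is bivariate $P$-polynomial of type $(\alpha,\beta)$ on $\mathcal{D}$ if its matrices are labelled $\{A_n\mid n\in\mathcal{D}\}$ with $A_n=v_n(A_{10},A_{01})$ for a $\preceq_{(\alpha,\beta)}$-compatible polynomial $v_n$ of multidegree $n$ for each $n\in\mathcal{D}$, and $\mathcal{D}$ is $\preceq_{(\alpha,\beta)}$-compatible. -}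

module Defs where

open import Level using (Level; _⊔_) renaming (suc to lsuc)
open import Data.Nat as ℕ using (ℕ; zero; suc)
open import Data.Fin using (Fin)
open import Data.Product using (_×_; _,_; proj₁; proj₂; Σ; ∃; ∃-syntax)
open import Data.Sum using (_⊎_)
open import Data.List using (List; []; _∷_)
open import Data.List.Membership.Propositional using (_∈_)
open import Data.List.Relation.Unary.Unique.Propositional using (Unique)
open import Relation.Nullary using (¬_; yes; no)
open import Relation.Binary.PropositionalEquality using (_≡_)
open import Data.Unit using (⊤)
import Data.Fin as Fin
open import Algebra.Bundles using (CommutativeRing)
open import Relation.Binary.Structures using (IsTotalOrder)

-- Fields and ordered fields (the paper works over ℂ resp. ℝ; we quantify
-- over an arbitrary field of scalars and an arbitrary ordered field for
-- the parameters α, β).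

record Field c ℓ : Set (lsuc (c ⊔ ℓ)) where
  field
    commutativeRing : CommutativeRing c ℓ
  open CommutativeRing commutativeRing public
  field
    0≉1     : ¬ (0# ≈ 1#)
    inverse : ∀ x → ¬ (x ≈ 0#) → ∃[ y ] (x * y ≈ 1#)

record OrderedField c ℓ₁ ℓ₂ : Set (lsuc (c ⊔ ℓ₁ ⊔ ℓ₂)) where
  field
    fld : Field c ℓ₁
  open Field fld public
  field
    _≤_          : Carrier → Carrier → Set ℓ₂
    isTotalOrder : IsTotalOrder _≈_ _≤_
    +-mono       : ∀ {x y} z → x ≤ y → (x + z) ≤ (y + z)
    *-nonneg     : ∀ {x y} → 0# ≤ x → 0# ≤ y → 0# ≤ (x * y)

  _<_ : Carrier → Carrier → Set (ℓ₁ ⊔ ℓ₂)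
  x < y = (x ≤ y) × ¬ (x ≈ y)

  ι : ℕ → Carrier
  ι zero    = 0#
  ι (suc n) = 1# + ι n

ℕ² : Set
ℕ² = ℕ × ℕ

e₁ e₂ : ℕ²
e₁ = (1 , 0)
e₂ = (0 , 1)

_+²_ : ℕ² → ℕ² → ℕ²
(a , b) +² (c , d) = (a ℕ.+ c , b ℕ.+ d)

_≤dl_ : ℕ² → ℕ² → Set
(i , j) ≤dl (i' , j') = (i ℕ.+ j ℕ.< i' ℕ.+ j') ⊎ ((i ℕ.+ j ≡ i' ℕ.+ j') × (j ℕ.≤ j'))

_≤cw_ : ℕ² → ℕ² → Set
(i , j) ≤cw (i' , j') = (i ℕ.≤ i') × (j ℕ.≤ j')

module _ {c ℓ₁ ℓ₂} (F : OrderedField c ℓ₁ ℓ₂) where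
  open OrderedField F

  Prec : Carrier → Carrier → ℕ² → ℕ² → Set ℓ₂
  Prec α β (i , j) (i' , j') =
    ((ι i + α * ι j) ≤ (ι i' + α * ι j')) × ((β * ι i + ι j) ≤ (β * ι i' + ι j'))

module Scheme {c ℓ} (K : Field c ℓ) where
  open Field K

  Mat : ℕ → Set c
  Mat N = Fin N → Fin N → Carrier

  sumFin : ∀ {n} → (Fin n → Carrier) → Carrier
  sumFin {zero}  f = 0#
  sumFin {suc n} f = f Fin.zero + sumFin (λ i → f (Fin.suc i))

  module _ {N : ℕ} where
    _≈M_ : Mat N → Mat N → Set ℓ
    A ≈M B = ∀ i j → A i j ≈ B i j

    _*M_ : Mat N → Mat N → Mat N
    (A *M B) i j = sumFin (λ k → A i k * B k j)

    _+M_ : Mat N → Mat N → Mat N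
    (A +M B) i j = A i j + B i j

    _·M_ : Carrier → Mat N → Mat N
    (x ·M A) i j = x * A i j

    0M : Mat N
    0M i j = 0#

    IM : Mat N
    IM i j with i Fin.≟ j
    ... | yes _ = 1#
    ... | no _  = 0#

    JM : Mat N
    JM i j = 1#

    _ᵀ : Mat N → Mat N
    (A ᵀ) i j = A j i

    _^M_ : Mat N → ℕ → Mat N
    A ^M zero  = IM
    A ^M suc n = A *M (A ^M n)

    lincomb : List ℕ² → (ℕ² → Carrier) → (ℕ² → Mat N) → Mat N
    lincomb []       cf B = 0M
    lincomb (k ∷ ks) cf B = (cf k ·M B k) +M lincomb ks cf B

    sumL : List ℕ² → (ℕ² → Mat N) → Mat N
    sumL []       B = 0M
    sumL (k ∷ ks) B = B k +M sumL ks B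

    InSpan : ∀ {p} (P : ℕ² → Set p) → List ℕ² → (ℕ² → Mat N) → Mat N → Set (c ⊔ ℓ ⊔ p)
    InSpan P ks B M =
      ∃[ cf ] ((∀ k → ¬ (cf k ≈ 0#) → (k ∈ ks) × P k) × (M ≈M lincomb ks cf B))

  -- A commutative association scheme {A_n | n ∈ D} on N points; the index
  -- set D ⊂ ℕ² is the duplicate-free list Ds, and A n is only relevant for n ∈ Ds.
  record IsCommAssocScheme (N : ℕ) (Ds : List ℕ²) (A : ℕ² → Mat N) : Set (c ⊔ ℓ) where
    field
      distinct   : Unique Ds
      zero-one   : ∀ n → n ∈ Ds → ∀ i j → (A n i j ≈ 0#) ⊎ (A n i j ≈ 1#)
      has-I      : ∃[ n ] ((n ∈ Ds) × (A n ≈M IM))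
      sum-J      : sumL Ds A ≈M JM
      transpose  : ∀ n → n ∈ Ds → ∃[ n' ] ((n' ∈ Ds) × ((A n ᵀ) ≈M A n'))
      commute    : ∀ n m → n ∈ Ds → m ∈ Ds → (A n *M A m) ≈M (A m *M A n)
      mult-close : ∀ n m → n ∈ Ds → m ∈ Ds → InSpan (λ _ → ⊤) Ds A (A n *M A m)

  -- Bivariate polynomials are given by coefficient functions f : ℕ² → K.
  -- f has multidegree n: every monomial exponent a (f a ≉ 0) satisfies a ≤ n
  -- in deg-lex order, and f n ≉ 0.
  HasMultidegree : (ℕ² → Carrier) → ℕ² → Set (ℓ)
  HasMultidegree f n = (∀ a → ¬ (f a ≈ 0#) → a ≤dl n) × ¬ (f n ≈ 0#)

  -- evaluation v(X,Y) = Σ_{i,j ≤ d} f(i,j) X^i Y^j  (for f of multidegree n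
  -- all monomials have i,j ≤ d = n₁ + n₂)
  eval : ∀ {N} → ℕ → (ℕ² → Carrier) → Mat N → Mat N → Mat N
  eval {N} d f X Y = go (suc d)
    where
      row : ℕ → ℕ → Mat N
      row i zero    = 0M
      row i (suc j) = (f (i , j) ·M ((X ^M i) *M (Y ^M j))) +M row i j
      go : ℕ → Mat N
      go zero    = 0M
      go (suc i) = row i (suc d) +M go i

  degOf : ℕ² → ℕ
  degOf (i , j) = i ℕ.+ j

  module _ {N : ℕ} (A : ℕ² → Mat N) where
    A₁₀ A₀₁ : Mat N
    A₁₀ = A e₁
    A₀₁ = A e₂

    Amon : ℕ² → Mat N
    Amon (a₁ , a₂) = (A₁₀ ^M a₁) *M (A₀₁ ^M a₂)

  record IsBivariatePPoly (N : ℕ) (Ds : List ℕ²) (A : ℕ² → Mat N) : Set (c ⊔ ℓ) where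
    field
      scheme  : IsCommAssocScheme N Ds A
      e₁∈D    : e₁ ∈ Ds
      e₂∈D    : e₂ ∈ Ds
      lower   : ∀ n n' → n ∈ Ds → n' ≤cw n → n' ∈ Ds
      poly    : ∀ n → n ∈ Ds → ∃[ f ] (HasMultidegree f n
                  × (∀ a → ¬ (f a ≈ 0#) → a ∈ Ds)
                  × (A n ≈M eval (degOf n) f (A₁₀ A) (A₀₁ A)))
      recur₁  : ∀ a → a ∈ Ds →
                  InSpan (λ b → b ≤dl (a +² e₁)) Ds (Amon A) (A₁₀ A *M Amon A a)
      recur₂  : ∀ a → a ∈ Ds →
                  InSpan (λ b → b ≤dl (a +² e₂)) Ds (Amon A) (A₀₁ A *M Amon A a)

  module _ {c' ℓ₁ ℓ₂} (F : OrderedField c' ℓ₁ ℓ₂) where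
    open OrderedField F using () renaming (Carrier to R)

    record IsCompatibleBivariatePPoly (α β : R) (N : ℕ) (Ds : List ℕ²)
           (A : ℕ² → Mat N) : Set (c ⊔ ℓ ⊔ ℓ₂) where
      field
        pPoly   : IsBivariatePPoly N Ds A
        poly⪯   : ∀ n → n ∈ Ds → ∃[ f ] (HasMultidegree f n
                    × (∀ a → ¬ (f a ≈ 0#) → a ∈ Ds)
                    × (∀ a → ¬ (f a ≈ 0#) → Prec F α β a n)
                    × (A n ≈M eval (degOf n) f (A₁₀ A) (A₀₁ A)))
        recur₁⪯ : ∀ a → a ∈ Ds → InSpan (λ b → Prec F α β b (a +² e₁)) Ds (Amon A) (A₁₀ A *M Amon A a)
        recur₂⪯ : ∀ a → a ∈ Ds → InSpan (λ b → Prec F α β b (a +² e₂)) Ds (Amon A) (A₀₁ A *M Amon A a)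

    DomainCompatible : (α β : R) → List ℕ² → Set ℓ₂
    DomainCompatible α β Ds = ∀ a b → a ∈ Ds → Prec F α β b a → b ∈ Ds

    record IsTypeBivariatePPoly (α β : R) (N : ℕ) (Ds : List ℕ²)
           (A : ℕ² → Mat N) : Set (c ⊔ ℓ ⊔ ℓ₂) where
      field
        scheme  : IsCommAssocScheme N Ds A
        poly⪯   : ∀ n → n ∈ Ds → ∃[ f ] (HasMultidegree f n
                    × (∀ a → ¬ (f a ≈ 0#) → Prec F α β a n)
                    × (A n ≈M eval (degOf n) f (A₁₀ A) (A₀₁ A)))
        domain⪯ : DomainCompatible α β Ds

{-# OPTIONS --safe #-}
module Submission where

open import Defs
open import Level using (Level)
open import Data.Nat using (ℕ)
open import Data.List using (List)
open import Function.Bundles using (_⇔_; mk⇔)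
open import Data.Product using (_,_)

-- A compatible scheme already has ⪯-compatible defining polynomials, so the
-- only ingredient of "type (α,β)" it may lack is compatibility of the domain.

module _ {c ℓ c' ℓ₁ ℓ₂} (K : Field c ℓ) (F : OrderedField c' ℓ₁ ℓ₂) where
  open Scheme K
  open OrderedField F using () renaming (Carrier to R)

  compatible∧domain⇒type : ∀ {α β : R} {N} {Ds : List ℕ²} {A : ℕ² → Mat N} →
    IsCompatibleBivariatePPoly F α β N Ds A → DomainCompatible F α β Ds →
    IsTypeBivariatePPoly F α β N Ds A
  compatible∧domain⇒type C domain = record
    { scheme  = IsBivariatePPoly.scheme pPoly
    ; poly⪯   = λ n n∈Ds → let (f , deg , _ , f⪯ , A≈f) = poly⪯ n n∈Ds in f , deg , f⪯ , A≈f
    ; domain⪯ = domain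
    }
    where open IsCompatibleBivariatePPoly C

proposition5p14 : ∀ {c ℓ c' ℓ₁ ℓ₂ : Level} (K : Field c ℓ) (F : OrderedField c' ℓ₁ ℓ₂)
    (α β : OrderedField.Carrier F) →
    OrderedField._≤_ F (OrderedField.0# F) α → OrderedField._≤_ F α (OrderedField.1# F) →
    OrderedField._≤_ F (OrderedField.0# F) β → OrderedField._<_ F β (OrderedField.1# F) →
    (N : ℕ) (Ds : List ℕ²) (A : ℕ² → Scheme.Mat K N) →
    Scheme.IsCompatibleBivariatePPoly K F α β N Ds A →
    (Scheme.IsTypeBivariatePPoly K F α β N Ds A ⇔ Scheme.DomainCompatible K F α β Ds)
proposition5p14 K F α β _ _ _ _ N Ds A C =
  mk⇔ Scheme.IsTypeBivariatePPoly.domain⪯ (compatible∧domain⇒type K F C)
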